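{- The two categories $\mathbf{CM_{id}}$ and $\mathbf{CM_{inv}}$ are adjoint equivalent: the inclusion functor $\iota\colon \mathbf{CM_{id}}\to\mathbf{CM_{inv}}$ is full and essentially surjective, and the functor $R$ is right adjoint to $\iota$.
   Context: Let $\mathbb K$ be a field of characteristic zero. For Lie algebras $\mathfrak g,\mathfrak h$ and a Lie algebra morphism $\upsilon\colon\mathfrak g\to\operatorname{Der}(\mathfrak h)$, a crossed morphism relative to $\upsilon$ is a linear map $\phi\colon\mathfrak g\to\mathfrak h$ with $\phi([x,y]_{\mathfrak g})=\upsilon_x(\phi(y))-\upsilon_y(\phi(x))+[\phi(x),\phi(y)]_{\mathfrak h}$ for all $x,y\in\mathfrak g$. The category $\mathbf{CM}$ has objects the tuples $(\mathfrak g,\mathfrak h,\upsilon,\phi)$ with $\upsilon\in\operatorname{Hom}_{\mathrm{Lie}}(\mathfrak g,\operatorname{Der}(\mathfrak h))$ and $\phi$ a crossed morphism relative to $\upsilon$; morphisms $(\mathfrak g,\mathfrak h,\upsilon,\phi)\to(\mathfrak g',\mathfrak h',\upsilon',\phi')$ are pairs of Lie algebra morphisms $(f,g)$, $f\colon\mathfrak g\to\mathfrak g'$, $g\colon\mathfrak h\to\mathfrak h'$, such that $g\circ\phi=\phi'\circ f$ and $g(\upsilon_x(a))=\upsilon'_{f(x)}(g(a))$ for all $x\in\mathfrak g$, $a\in\mathfrak h$. $\mathbf{CM_{inv}}\subset\mathbf{CM}$ is the subcategory of tuples with $\phi$ invertible. For a Lie algebra $\mathfrak h$ with $\upsilon\colon\mathfrak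 h\to\operatorname{Der}(\mathfrak h)$, $\overline{\mathfrak h}$ denotes the vector space $\mathfrak h$ with bracket $\llbracket x,y\rrbracket=\upsilon_x(y)-\upsilon_y(x)+[x,y]_{\mathfrak h}$; $\mathbf{CM_{id}}\subset\mathbf{CM_{inv}}$ is the subcategory of tuples of the form $(\overline{\mathfrak h},\mathfrak h,\upsilon,\mathrm{id})$, with inclusion functor $\iota$. The functor $R\colon\mathbf{CM_{inv}}\to\mathbf{CM_{id}}$ is given by $R(\mathfrak g,\mathfrak h,\upsilon,\phi)=(\overline{\mathfrak h},\mathfrak h,\upsilon\circ\phi^{ -1},\mathrm{id})$ (so the bracket of $\overline{\mathfrak h}$ is $\llbracket x,y\rrbracket=\upsilon_{\phi^{ -1}(x)}(y)-\upsilon_{\phi^{ -1}(y)}(x)+[x,y]_{\mathfrak h}$) and $R(f,g)=(g,g)$. -}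

module Defs where

open import Level using (Level; _⊔_) renaming (suc to lsuc)
open import Data.Nat using (ℕ; zero) renaming (suc to sucℕ)
open import Data.Product using (Σ; _×_; _,_; proj₁; proj₂)
open import Relation.Nullary using (¬_)
open import Algebra.Bundles using (CommutativeRing)
open import Algebra.Module.Bundles using (Module)
import Algebra.Properties.Group as GroupProps
import Relation.Binary.Reasoning.Setoid as SetoidR

module _ {k kℓ : Level} (K : CommutativeRing k kℓ) where
  open CommutativeRing K

  record IsField : Set (k ⊔ kℓ) where
    field
      1≉0 : ¬ (1# ≈ 0#)
      inv : ∀ x → ¬ (x ≈ 0#) → Σ Carrier λ y → x * y ≈ 1#

  _·1 : ℕ → Carrier
  zero ·1 = 0#
  sucℕ n ·1 = 1# + (n ·1)

  CharZero : Set kℓ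
  CharZero = ∀ n → ¬ ((sucℕ n) ·1 ≈ 0#)

module CM {k kℓ : Level} (K : CommutativeRing k kℓ) (c ℓ : Level) where

  Mod : Set (k ⊔ kℓ ⊔ lsuc (c ⊔ ℓ))
  Mod = Module K c ℓ

  record IsLieBracket (M : Mod)
           (br : Module.Carrierᴹ M → Module.Carrierᴹ M → Module.Carrierᴹ M)
           : Set (k ⊔ c ⊔ ℓ) where
    open Module M
    field
      br-cong   : ∀ {x x' y y'} → x ≈ᴹ x' → y ≈ᴹ y' → br x y ≈ᴹ br x' y'
      br-+ˡ     : ∀ x y z → br (x +ᴹ y) z ≈ᴹ br x z +ᴹ br y z
      br-*ˡ     : ∀ r x y → br (r *ₗ x) y ≈ᴹ r *ₗ br x y
      br-+ʳ     : ∀ x y z → br x (y +ᴹ z) ≈ᴹ br x y +ᴹ br x z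
      br-*ʳ     : ∀ r x y → br x (r *ₗ y) ≈ᴹ r *ₗ br x y
      br-alt    : ∀ x → br x x ≈ᴹ 0ᴹ
      br-jacobi : ∀ x y z →
        (br x (br y z) +ᴹ br y (br z x)) +ᴹ br z (br x y) ≈ᴹ 0ᴹ

  record LieAlgebra : Set (k ⊔ kℓ ⊔ lsuc (c ⊔ ℓ)) where
    field
      vs : Mod
    open Module vs public
    field
      [_,_] : Carrierᴹ → Carrierᴹ → Carrierᴹ
      isLie : IsLieBracket vs [_,_]
    open IsLieBracket isLie public

    _-ᴹ_ : Carrierᴹ → Carrierᴹ → Carrierᴹ
    x -ᴹ y = x +ᴹ (-ᴹ y)

    refl : ∀ {x} → x ≈ᴹ x
    refl = ≈ᴹ-refl
    sym : ∀ {x y} → x ≈ᴹ y → y ≈ᴹ x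
    sym = ≈ᴹ-sym
    trans : ∀ {x y z} → x ≈ᴹ y → y ≈ᴹ z → x ≈ᴹ z
    trans = ≈ᴹ-trans

  record IsLinear (M N : Mod) (f : Module.Carrierᴹ M → Module.Carrierᴹ N)
           : Set (k ⊔ c ⊔ ℓ) where
    private
      module M = Module M
      module N = Module N
    field
      f-cong : ∀ {x y} → x M.≈ᴹ y → f x N.≈ᴹ f y
      f-+    : ∀ x y → f (x M.+ᴹ y) N.≈ᴹ f x N.+ᴹ f y
      f-*    : ∀ r x → f (r M.*ₗ x) N.≈ᴹ r N.*ₗ f x

  record IsLieHom (L L' : LieAlgebra)
           (f : LieAlgebra.Carrierᴹ L → LieAlgebra.Carrierᴹ L')
           : Set (k ⊔ c ⊔ ℓ) where
    private
      module L = LieAlgebra L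
      module L' = LieAlgebra L'
    field
      linear : IsLinear L.vs L'.vs f
      hom-br : ∀ x y → f L.[ x , y ] L'.≈ᴹ L'.[ f x , f y ]
    open IsLinear linear public

  record LieHom (L L' : LieAlgebra) : Set (k ⊔ c ⊔ ℓ) where
    field
      fun : LieAlgebra.Carrierᴹ L → LieAlgebra.Carrierᴹ L'
      isLieHom : IsLieHom L L' fun
    open IsLieHom isLieHom public

  -- υ : 𝔤 → Der(𝔥) is a Lie algebra morphism (written out: each υ x is
  -- a derivation of 𝔥, υ is linear, and υ [x,y] = [υ x, υ y] for the
  -- commutator bracket of Der(𝔥); equality in Der(𝔥) is pointwise).
  record IsDerAction (G H : LieAlgebra)
           (υ : LieAlgebra.Carrierᴹ G → LieAlgebra.Carrierᴹ H → LieAlgebra.Carrierᴹ H)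
           : Set (k ⊔ c ⊔ ℓ) where
    private
      module G = LieAlgebra G
      module H = LieAlgebra H
    field
      υ-cong    : ∀ {x x' a a'} → x G.≈ᴹ x' → a H.≈ᴹ a' → υ x a H.≈ᴹ υ x' a'
      υ-+ʳ      : ∀ x a b → υ x (a H.+ᴹ b) H.≈ᴹ υ x a H.+ᴹ υ x b
      υ-*ʳ      : ∀ x r a → υ x (r H.*ₗ a) H.≈ᴹ r H.*ₗ υ x a
      υ-leibniz : ∀ x a b → υ x H.[ a , b ] H.≈ᴹ H.[ υ x a , b ] H.+ᴹ H.[ a , υ x b ]
      υ-+ˡ      : ∀ x y a → υ (x G.+ᴹ y) a H.≈ᴹ υ x a H.+ᴹ υ y a
      υ-*ˡ      : ∀ r x a → υ (r G.*ₗ x) a H.≈ᴹ r H.*ₗ υ x a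
      υ-br      : ∀ x y a → υ G.[ x , y ] a H.≈ᴹ υ x (υ y a) H.-ᴹ υ y (υ x a)

  record IsCrossed (G H : LieAlgebra)
           (υ : LieAlgebra.Carrierᴹ G → LieAlgebra.Carrierᴹ H → LieAlgebra.Carrierᴹ H)
           (φ : LieAlgebra.Carrierᴹ G → LieAlgebra.Carrierᴹ H)
           : Set (k ⊔ c ⊔ ℓ) where
    private
      module G = LieAlgebra G
      module H = LieAlgebra H
    field
      φ-linear : IsLinear G.vs H.vs φ
      crossed  : ∀ x y →
        φ G.[ x , y ] H.≈ᴹ (υ x (φ y) H.-ᴹ υ y (φ x)) H.+ᴹ H.[ φ x , φ y ]
    open IsLinear φ-linear public

  record CMObj : Set (k ⊔ kℓ ⊔ lsuc (c ⊔ ℓ)) where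
    field
      𝔤 𝔥 : LieAlgebra
      υ : LieAlgebra.Carrierᴹ 𝔤 → LieAlgebra.Carrierᴹ 𝔥 → LieAlgebra.Carrierᴹ 𝔥
      υ-act : IsDerAction 𝔤 𝔥 υ
      φ : LieAlgebra.Carrierᴹ 𝔤 → LieAlgebra.Carrierᴹ 𝔥
      φ-crossed : IsCrossed 𝔤 𝔥 υ φ
    open IsDerAction υ-act public
    open IsCrossed φ-crossed public

  record CMHom (X Y : CMObj) : Set (k ⊔ c ⊔ ℓ) where
    private
      module X = CMObj X
      module Y = CMObj Y
      module Y𝔥 = LieAlgebra Y.𝔥
    field
      f : LieHom X.𝔤 Y.𝔤
      g : LieHom X.𝔥 Y.𝔥
    private
      module f = LieHom f
      module g = LieHom g
    field
      g∘φ : ∀ x → g.fun (X.φ x) Y𝔥.≈ᴹ Y.φ (f.fun x)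
      g∘υ : ∀ x a → g.fun (X.υ x a) Y𝔥.≈ᴹ Y.υ (f.fun x) (g.fun a)

  _≈Hom_ : ∀ {X Y} → CMHom X Y → CMHom X Y → Set (c ⊔ ℓ)
  _≈Hom_ {X} {Y} m n =
    (∀ x → LieAlgebra._≈ᴹ_ (CMObj.𝔤 Y) (LieHom.fun (CMHom.f m) x) (LieHom.fun (CMHom.f n) x))
    × (∀ a → LieAlgebra._≈ᴹ_ (CMObj.𝔥 Y) (LieHom.fun (CMHom.g m) a) (LieHom.fun (CMHom.g n) a))

  idLieHom : ∀ L → LieHom L L
  idLieHom L = record
    { fun = λ x → x
    ; isLieHom = record
      { linear = record { f-cong = λ p → p ; f-+ = λ _ _ → refl ; f-* = λ _ _ → refl }
      ; hom-br = λ _ _ → refl } }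
    where open LieAlgebra L

  _∘L_ : ∀ {L₁ L₂ L₃} → LieHom L₂ L₃ → LieHom L₁ L₂ → LieHom L₁ L₃
  _∘L_ {L₁} {L₂} {L₃} p q = record
    { fun = λ x → p.fun (q.fun x)
    ; isLieHom = record
      { linear = record
        { f-cong = λ e → p.f-cong (q.f-cong e)
        ; f-+ = λ x y → L₃.trans (p.f-cong (q.f-+ x y)) (p.f-+ _ _)
        ; f-* = λ r x → L₃.trans (p.f-cong (q.f-* r x)) (p.f-* _ _) }
      ; hom-br = λ x y → L₃.trans (p.f-cong (q.hom-br x y)) (p.hom-br _ _) } }
    where
      module p = LieHom p
      module q = LieHom q
      module L₃ = LieAlgebra L₃

  idHom : ∀ X → CMHom X X
  idHom X = record
    { f = idLieHom X.𝔤 ; g = idLieHom X.𝔥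
    ; g∘φ = λ _ → H.refl ; g∘υ = λ _ _ → H.refl }
    where
      module X = CMObj X
      module H = LieAlgebra X.𝔥

  _∘Hom_ : ∀ {X Y Z} → CMHom Y Z → CMHom X Y → CMHom X Z
  _∘Hom_ {X} {Y} {Z} m n = record
    { f = m.f ∘L n.f ; g = m.g ∘L n.g
    ; g∘φ = λ x → Z𝔥.trans (mg.f-cong (n.g∘φ x)) (m.g∘φ _)
    ; g∘υ = λ x a → Z𝔥.trans (mg.f-cong (n.g∘υ x a)) (m.g∘υ _ _) }
    where
      module m = CMHom m
      module n = CMHom n
      module mg = LieHom m.g
      module Z𝔥 = LieAlgebra (CMObj.𝔥 Z)

  -- Objects of CM_inv: φ invertible (inverse as a map of setoids).
  -- Morphisms of CM_inv are all CM-morphisms between the underlying objects.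
  record CMinvObj : Set (k ⊔ kℓ ⊔ lsuc (c ⊔ ℓ)) where
    field
      obj : CMObj
    open CMObj obj
    private
      module G = LieAlgebra 𝔤
      module H = LieAlgebra 𝔥
    field
      ψ : H.Carrierᴹ → G.Carrierᴹ
      ψ-cong : ∀ {a b} → a H.≈ᴹ b → ψ a G.≈ᴹ ψ b
      ψ∘φ : ∀ x → ψ (φ x) G.≈ᴹ x
      φ∘ψ : ∀ a → φ (ψ a) H.≈ᴹ a

  record _≅inv_ (X Y : CMinvObj) : Set (k ⊔ c ⊔ ℓ) where
    private
      module X = CMinvObj X
      module Y = CMinvObj Y
    field
      to   : CMHom X.obj Y.obj
      from : CMHom Y.obj X.obj
      from∘to : (from ∘Hom to) ≈Hom idHom X.obj
      to∘from : (to ∘Hom from) ≈Hom idHom Y.obj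

  barBr : (H : LieAlgebra) →
          (LieAlgebra.Carrierᴹ H → LieAlgebra.Carrierᴹ H → LieAlgebra.Carrierᴹ H) →
          LieAlgebra.Carrierᴹ H → LieAlgebra.Carrierᴹ H → LieAlgebra.Carrierᴹ H
  barBr H υ x y = (υ x y -ᴹ υ y x) +ᴹ [ x , y ]
    where open LieAlgebra H

  bar : (H : LieAlgebra) →
        (υ : LieAlgebra.Carrierᴹ H → LieAlgebra.Carrierᴹ H → LieAlgebra.Carrierᴹ H) →
        IsLieBracket (LieAlgebra.vs H) (barBr H υ) → LieAlgebra
  bar H υ p = record { vs = LieAlgebra.vs H ; [_,_] = barBr H υ ; isLie = p }

  -- Objects of CM_id: tuples (𝔥‾, 𝔥, υ, id)
  record CMidObj : Set (k ⊔ kℓ ⊔ lsuc (c ⊔ ℓ)) where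
    field
      𝔥 : LieAlgebra
      υ : LieAlgebra.Carrierᴹ 𝔥 → LieAlgebra.Carrierᴹ 𝔥 → LieAlgebra.Carrierᴹ 𝔥
      bar-isLie : IsLieBracket (LieAlgebra.vs 𝔥) (barBr 𝔥 υ)
      υ-act : IsDerAction (bar 𝔥 υ bar-isLie) 𝔥 υ

  ιCM : CMidObj → CMObj
  ιCM A = record
    { 𝔤 = bar A.𝔥 A.υ A.bar-isLie ; 𝔥 = A.𝔥 ; υ = A.υ ; υ-act = A.υ-act
    ; φ = λ x → x
    ; φ-crossed = record
      { φ-linear = record { f-cong = λ p → p ; f-+ = λ _ _ → H.refl ; f-* = λ _ _ → H.refl }
      ; crossed = λ _ _ → H.refl } }
    where
      module A = CMidObj A
      module H = LieAlgebra A.𝔥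

  ι : CMidObj → CMinvObj
  ι A = record
    { obj = ιCM A ; ψ = λ x → x ; ψ-cong = λ p → p
    ; ψ∘φ = λ _ → H.refl ; φ∘ψ = λ _ → H.refl }
    where module H = LieAlgebra (CMidObj.𝔥 A)

  -- CM_id is the full subcategory on these objects
  CMidHom : CMidObj → CMidObj → Set (k ⊔ c ⊔ ℓ)
  CMidHom A B = CMHom (ιCM A) (ιCM B)

  _∘id_ : ∀ {A B C} → CMidHom B C → CMidHom A B → CMidHom A C
  m ∘id n = m ∘Hom n

  ιHom : ∀ {A B} → CMidHom A B → CMHom (CMinvObj.obj (ι A)) (CMinvObj.obj (ι B))
  ιHom m = m

  module LinFacts {M N : Mod} {f : Module.Carrierᴹ M → Module.Carrierᴹ N}
                  (lin : IsLinear M N f) where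
    private
      module M = Module M
      module N = Module N
    open IsLinear lin
    open SetoidR N.≈ᴹ-setoid

    f-0 : f M.0ᴹ N.≈ᴹ N.0ᴹ
    f-0 = begin
      f M.0ᴹ                                   ≈⟨ f-cong (M.≈ᴹ-sym (M.*ₗ-zeroˡ M.0ᴹ)) ⟩
      f (CommutativeRing.0# K M.*ₗ M.0ᴹ)       ≈⟨ f-* _ _ ⟩
      CommutativeRing.0# K N.*ₗ f M.0ᴹ         ≈⟨ N.*ₗ-zeroˡ _ ⟩
      N.0ᴹ ∎

    f-neg : ∀ x → f (M.-ᴹ x) N.≈ᴹ N.-ᴹ (f x)
    f-neg x = GroupProps.inverseʳ-unique N.+ᴹ-group (f x) (f (M.-ᴹ x)) (begin
      f x N.+ᴹ f (M.-ᴹ x)   ≈⟨ N.≈ᴹ-sym (f-+ _ _) ⟩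
      f (x M.+ᴹ M.-ᴹ x)     ≈⟨ f-cong (M.-ᴹ‿inverseʳ x) ⟩
      f M.0ᴹ                ≈⟨ f-0 ⟩
      N.0ᴹ ∎)

  module InvFacts (X : CMinvObj) where
    open CMinvObj X
    module X = CMObj obj
    module G = LieAlgebra X.𝔤
    module H = LieAlgebra X.𝔥
    open LinFacts X.φ-linear

    ψ-+ : ∀ a b → ψ (a H.+ᴹ b) G.≈ᴹ ψ a G.+ᴹ ψ b
    ψ-+ a b = G.trans (ψ-cong (H.trans (H.+ᴹ-cong (H.sym (φ∘ψ a)) (H.sym (φ∘ψ b)))
                                        (H.sym (X.f-+ _ _))))
                      (ψ∘φ _)

    ψ-* : ∀ r a → ψ (r H.*ₗ a) G.≈ᴹ r G.*ₗ ψ a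
    ψ-* r a = G.trans (ψ-cong (H.trans (H.*ₗ-congˡ (H.sym (φ∘ψ a))) (H.sym (X.f-* _ _))))
                      (ψ∘φ _)

    T : H.Carrierᴹ → H.Carrierᴹ → H.Carrierᴹ
    T a b = X.φ G.[ ψ a , ψ b ]

    υ' : H.Carrierᴹ → H.Carrierᴹ → H.Carrierᴹ
    υ' a b = X.υ (ψ a) b

    bar≈T : ∀ a b → barBr X.𝔥 υ' a b H.≈ᴹ T a b
    bar≈T a b = H.sym (H.trans (X.crossed _ _)
      (H.+ᴹ-cong (H.+ᴹ-cong (X.υ-cong G.refl (φ∘ψ b)) (H.-ᴹ‿cong (X.υ-cong G.refl (φ∘ψ a))))
                 (H.br-cong (φ∘ψ a) (φ∘ψ b))))

    T-isLie : IsLieBracket H.vs T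
    T-isLie = record
      { br-cong = λ p q → X.f-cong (G.br-cong (ψ-cong p) (ψ-cong q))
      ; br-+ˡ = λ a b d → H.trans (X.f-cong (G.trans (G.br-cong (ψ-+ a b) G.refl) (G.br-+ˡ _ _ _)))
                                  (X.f-+ _ _)
      ; br-*ˡ = λ r a b → H.trans (X.f-cong (G.trans (G.br-cong (ψ-* r a) G.refl) (G.br-*ˡ _ _ _)))
                                  (X.f-* _ _)
      ; br-+ʳ = λ a b d → H.trans (X.f-cong (G.trans (G.br-cong G.refl (ψ-+ b d)) (G.br-+ʳ _ _ _)))
                                  (X.f-+ _ _)
      ; br-*ʳ = λ r a b → H.trans (X.f-cong (G.trans (G.br-cong G.refl (ψ-* r b)) (G.br-*ʳ _ _ _)))
                                  (X.f-* _ _)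
      ; br-alt = λ a → H.trans (X.f-cong (G.br-alt _)) f-0
      ; br-jacobi = λ a b d → H.trans
          (H.+ᴹ-cong (H.+ᴹ-cong (nest a b d) (nest b d a)) (nest d a b))
          (H.trans (H.+ᴹ-cong (H.sym (X.f-+ _ _)) H.refl)
          (H.trans (H.sym (X.f-+ _ _))
          (H.trans (X.f-cong (G.br-jacobi _ _ _)) f-0)))
      }
      where
        nest : ∀ a b d → T a (T b d) H.≈ᴹ X.φ G.[ ψ a , G.[ ψ b , ψ d ] ]
        nest a b d = X.f-cong (G.br-cong G.refl (ψ∘φ _))

    bar-isLie : IsLieBracket H.vs (barBr X.𝔥 υ')
    bar-isLie = record
      { br-cong = λ p q → H.trans (bar≈T _ _) (H.trans (T.br-cong p q) (H.sym (bar≈T _ _)))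
      ; br-+ˡ = λ a b d → H.trans (bar≈T _ _) (H.trans (T.br-+ˡ a b d)
                           (H.+ᴹ-cong (H.sym (bar≈T _ _)) (H.sym (bar≈T _ _))))
      ; br-*ˡ = λ r a b → H.trans (bar≈T _ _) (H.trans (T.br-*ˡ r a b)
                           (H.*ₗ-congˡ (H.sym (bar≈T _ _))))
      ; br-+ʳ = λ a b d → H.trans (bar≈T _ _) (H.trans (T.br-+ʳ a b d)
                           (H.+ᴹ-cong (H.sym (bar≈T _ _)) (H.sym (bar≈T _ _))))
      ; br-*ʳ = λ r a b → H.trans (bar≈T _ _) (H.trans (T.br-*ʳ r a b)
                           (H.*ₗ-congˡ (H.sym (bar≈T _ _))))
      ; br-alt = λ a → H.trans (bar≈T _ _) (T.br-alt a)
      ; br-jacobi = λ a b d → H.trans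
          (H.+ᴹ-cong (H.+ᴹ-cong (nest a b d) (nest b d a)) (nest d a b))
          (T.br-jacobi a b d)
      }
      where
        module T = IsLieBracket T-isLie
        B = barBr X.𝔥 υ'
        nest : ∀ a b d → B a (B b d) H.≈ᴹ T a (T b d)
        nest a b d = H.trans (bar≈T _ _) (T.br-cong H.refl (bar≈T _ _))

    υ'-act : IsDerAction (bar X.𝔥 υ' bar-isLie) X.𝔥 υ'
    υ'-act = record
      { υ-cong = λ p q → X.υ-cong (ψ-cong p) q
      ; υ-+ʳ = λ a → X.υ-+ʳ (ψ a)
      ; υ-*ʳ = λ a → X.υ-*ʳ (ψ a)
      ; υ-leibniz = λ a → X.υ-leibniz (ψ a)
      ; υ-+ˡ = λ a b d → H.trans (X.υ-cong (ψ-+ a b) H.refl) (X.υ-+ˡ _ _ _)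
      ; υ-*ˡ = λ r a d → H.trans (X.υ-cong (ψ-* r a) H.refl) (X.υ-*ˡ _ _ _)
      ; υ-br = λ a b d → H.trans
          (X.υ-cong (G.trans (ψ-cong (bar≈T a b)) (ψ∘φ _)) H.refl)
          (X.υ-br _ _ _)
      }

  -- the functor R on objects: (𝔤,𝔥,υ,φ) ↦ (𝔥‾, 𝔥, υ ∘ φ⁻¹, id)
  R₀ : CMinvObj → CMidObj
  R₀ X = record
    { 𝔥 = CMObj.𝔥 (CMinvObj.obj X)
    ; υ = I.υ'
    ; bar-isLie = I.bar-isLie
    ; υ-act = I.υ'-act }
    where module I = InvFacts X

  module RF {X Y : CMinvObj} (m : CMHom (CMinvObj.obj X) (CMinvObj.obj Y)) where
      module m = CMHom m
      module g = LieHom m.g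
      module f = LieHom m.f
      module X = InvFacts X
      module Y = InvFacts Y
      module XI = CMinvObj X
      module YI = CMinvObj Y
      module YH = LieAlgebra (CMObj.𝔥 (CMinvObj.obj Y))
      key : ∀ a → f.fun (XI.ψ a) Y.G.≈ᴹ YI.ψ (g.fun a)
      key a = Y.G.sym (Y.G.trans (YI.ψ-cong (YH.trans (g.f-cong (X.H.sym (XI.φ∘ψ a))) (m.g∘φ _)))
                                 (YI.ψ∘φ _))
      gυ : ∀ x a → g.fun (X.υ' x a) YH.≈ᴹ Y.υ' (g.fun x) (g.fun a)
      gυ x a = YH.trans (m.g∘υ _ _) (Y.X.υ-cong (key x) YH.refl)
      fneg : ∀ a → g.fun (X.H.-ᴹ a) YH.≈ᴹ YH.-ᴹ (g.fun a)
      fneg = LinFacts.f-neg g.linear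
      gbr : ∀ x y → g.fun (barBr X.X.𝔥 X.υ' x y) YH.≈ᴹ barBr Y.X.𝔥 Y.υ' (g.fun x) (g.fun y)
      gbr x y = YH.trans (g.f-+ _ _)
                (YH.+ᴹ-cong (YH.trans (g.f-+ _ _)
                              (YH.+ᴹ-cong (gυ x y) (YH.trans (fneg _) (YH.-ᴹ‿cong (gυ y x)))))
                            (g.hom-br x y))

  R₁ : ∀ {X Y} → CMHom (CMinvObj.obj X) (CMinvObj.obj Y) → CMidHom (R₀ X) (R₀ Y)
  R₁ {X} {Y} m = record
    { f = record
      { fun = g.fun
      ; isLieHom = record { linear = g.linear ; hom-br = gbr } }
    ; g = CMHom.g m
    ; g∘φ = λ _ → YH.refl
    ; g∘υ = gυ }
    where open RF {X} {Y} m

  IotaFull : Set (k ⊔ kℓ ⊔ lsuc (c ⊔ ℓ))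
  IotaFull = ∀ (A B : CMidObj) (m : CMHom (CMinvObj.obj (ι A)) (CMinvObj.obj (ι B))) →
             Σ (CMidHom A B) λ m' →
               _≈Hom_ {ιCM A} {ιCM B} (ιHom {A} {B} m') m

  IotaEssSurj : Set (k ⊔ kℓ ⊔ lsuc (c ⊔ ℓ))
  IotaEssSurj = ∀ (X : CMinvObj) → Σ CMidObj λ A → ι A ≅inv X

  -- R is right adjoint to ι: a bijection
  --   Hom_CMinv(ι A, X) ≅ Hom_CMid(A, R X)
  -- of hom-setoids, natural in A and X.
  HomL : CMidObj → CMinvObj → Set (k ⊔ c ⊔ ℓ)
  HomL A X = CMHom (CMinvObj.obj (ι A)) (CMinvObj.obj X)

  HomR : CMidObj → CMinvObj → Set (k ⊔ c ⊔ ℓ)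
  HomR A X = CMidHom A (R₀ X)

  record RRightAdjoint : Set (k ⊔ kℓ ⊔ lsuc (c ⊔ ℓ)) where
    field
      Φ : ∀ A X → HomL A X → HomR A X
      Ψ : ∀ A X → HomR A X → HomL A X
      Φ-cong : ∀ A X (m m' : HomL A X) →
               _≈Hom_ {ιCM A} {CMinvObj.obj X} m m' →
               _≈Hom_ {ιCM A} {ιCM (R₀ X)} (Φ A X m) (Φ A X m')
      Ψ-cong : ∀ A X (n n' : HomR A X) →
               _≈Hom_ {ιCM A} {ιCM (R₀ X)} n n' →
               _≈Hom_ {ιCM A} {CMinvObj.obj X} (Ψ A X n) (Ψ A X n')
      Ψ∘Φ : ∀ A X (m : HomL A X) →
            _≈Hom_ {ιCM A} {CMinvObj.obj X} (Ψ A X (Φ A X m)) m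
      Φ∘Ψ : ∀ A X (n : HomR A X) →
            _≈Hom_ {ιCM A} {ιCM (R₀ X)} (Φ A X (Ψ A X n)) n
      Φ-natural : ∀ (A' A : CMidObj) (X X' : CMinvObj)
                  (a : CMidHom A' A) (x : CMHom (CMinvObj.obj X) (CMinvObj.obj X'))
                  (m : HomL A X) →
                  _≈Hom_ {ιCM A'} {ιCM (R₀ X')}
                    (Φ A' X' (_∘Hom_ {ιCM A'} {CMinvObj.obj X} {CMinvObj.obj X'} x
                               (_∘Hom_ {ιCM A'} {ιCM A} {CMinvObj.obj X} m (ιHom {A'} {A} a))))
                    (_∘id_ {A'} {R₀ X} {R₀ X'} (R₁ {X} {X'} x)
                       (_∘id_ {A'} {A} {R₀ X} (Φ A X m) a))

{-# OPTIONS --safe #-}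
module Submission where

-- Every object X = (𝔤, 𝔥, υ, φ) of CM_inv is isomorphic to ι (R X): the pair
-- (φ⁻¹, id) is a morphism ι (R X) → X, because the crossed-morphism identity
-- says exactly that φ carries [-,-]_𝔤 to the bracket ⟦-,-⟧ of 𝔥‾.  This
-- counit ε is invertible, and a morphism (f, g) : ι A → X is determined by
-- its second component g, since on ι A the crossed morphism is the identity
-- and hence f = φ⁻¹ ∘ g.  So m ↦ (g, g) and n ↦ ε ∘ n are mutually inverse.

open import Defs
open import Level using (Level)
open import Data.Product using (_×_; _,_)
open import Algebra.Bundles using (CommutativeRing)

module Adjunction {k kℓ : Level} (K : CommutativeRing k kℓ) (c ℓ : Level) where
  open CM K c ℓ

  ι-full : IotaFull
  ι-full A B m = m , (λ _ → B.refl) , (λ _ → B.refl)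
    where module B = LieAlgebra (CMidObj.𝔥 B)

  module _ (X : CMinvObj) where
    open InvFacts X
    open CMinvObj X using (obj; ψ; ψ-cong; ψ∘φ; φ∘ψ)

    counit : CMHom (ιCM (R₀ X)) obj
    counit = record
      { f = record
        { fun = ψ
        ; isLieHom = record
          { linear = record { f-cong = ψ-cong ; f-+ = ψ-+ ; f-* = ψ-* }
          ; hom-br = λ a b → G.trans (ψ-cong (bar≈T a b)) (ψ∘φ _) } }
      ; g = idLieHom X.𝔥
      ; g∘φ = λ a → H.sym (φ∘ψ a)
      ; g∘υ = λ _ _ → H.refl }

    counit⁻¹ : CMHom obj (ιCM (R₀ X))
    counit⁻¹ = record
      { f = record
        { fun = X.φ
        ; isLieHom = record
          { linear = X.φ-linear
          ; hom-br = λ x y →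
              H.sym (H.trans (bar≈T _ _) (X.f-cong (G.br-cong (ψ∘φ x) (ψ∘φ y)))) } }
      ; g = idLieHom X.𝔥
      ; g∘φ = λ _ → H.refl
      ; g∘υ = λ x _ → X.υ-cong (G.sym (ψ∘φ x)) H.refl }

    counit-iso : ι (R₀ X) ≅inv X
    counit-iso = record
      { to = counit
      ; from = counit⁻¹
      ; from∘to = φ∘ψ , (λ _ → H.refl)
      ; to∘from = ψ∘φ , (λ _ → H.refl) }

  ι-essSurj : IotaEssSurj
  ι-essSurj X = R₀ X , counit-iso X

  -- R (ι A) has the same bracket as A but a different proof of the Lie axioms,
  -- so the identity must be built by hand rather than with idLieHom.
  unit : ∀ A → CMidHom A (R₀ (ι A))
  unit A = record
    { f = record
      { fun = λ x → x
      ; isLieHom = record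
        { linear = record { f-cong = λ p → p ; f-+ = λ _ _ → H.refl ; f-* = λ _ _ → H.refl }
        ; hom-br = λ _ _ → H.refl } }
    ; g = idLieHom (CMidObj.𝔥 A)
    ; g∘φ = λ _ → H.refl
    ; g∘υ = λ _ _ → H.refl }
    where module H = LieAlgebra (CMidObj.𝔥 A)

  transpose : ∀ A X → HomL A X → HomR A X
  transpose A X m = _∘id_ {A} {R₀ (ι A)} {R₀ X} (R₁ {ι A} {X} m) (unit A)

  untranspose : ∀ A X → HomR A X → HomL A X
  untranspose A X n = _∘Hom_ {ιCM A} {ιCM (R₀ X)} {CMinvObj.obj X} (counit X) n

  untranspose-transpose : ∀ A X (m : HomL A X) →
    _≈Hom_ {ιCM A} {CMinvObj.obj X} (untranspose A X (transpose A X m)) m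
  untranspose-transpose A X m =
    (λ x → G.trans (ψ-cong (CMHom.g∘φ m x)) (ψ∘φ _)) , (λ _ → H.refl)
    where
      open InvFacts X using (module G; module H)
      open CMinvObj X using (ψ-cong; ψ∘φ)

  transpose-untranspose : ∀ A X (n : HomR A X) →
    _≈Hom_ {ιCM A} {ιCM (R₀ X)} (transpose A X (untranspose A X n)) n
  transpose-untranspose A X n = CMHom.g∘φ n , (λ _ → H.refl)
    where open InvFacts X using (module H)

  transpose-natural : ∀ (A' A : CMidObj) (X X' : CMinvObj)
    (a : CMidHom A' A) (x : CMHom (CMinvObj.obj X) (CMinvObj.obj X')) (m : HomL A X) →
    _≈Hom_ {ιCM A'} {ιCM (R₀ X')}
      (transpose A' X' (_∘Hom_ {ιCM A'} {CMinvObj.obj X} {CMinvObj.obj X'} x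
                         (_∘Hom_ {ιCM A'} {ιCM A} {CMinvObj.obj X} m (ιHom {A'} {A} a))))
      (_∘id_ {A'} {R₀ X} {R₀ X'} (R₁ {X} {X'} x) (_∘id_ {A'} {A} {R₀ X} (transpose A X m) a))
  transpose-natural A' A X X' a x m =
    (λ t → x.f-cong (m.f-cong (CMHom.g∘φ a t))) , (λ _ → H.refl)
    where
      module x = LieHom (CMHom.g x)
      module m = LieHom (CMHom.g m)
      open InvFacts X' using (module H)

  R-rightAdjoint : RRightAdjoint
  R-rightAdjoint = record
    { Φ = transpose
    ; Ψ = untranspose
    ; Φ-cong = λ _ _ _ _ (_ , g≈g') → g≈g' , g≈g'
    ; Ψ-cong = λ _ X _ _ (f≈f' , g≈g') → (λ a → CMinvObj.ψ-cong X (f≈f' a)) , g≈g'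
    ; Ψ∘Φ = untranspose-transpose
    ; Φ∘Ψ = transpose-untranspose
    ; Φ-natural = transpose-natural }

mainTheorem1 : ∀ {k kℓ : Level} (K : CommutativeRing k kℓ) → IsField K → CharZero K →
    (c ℓ : Level) →
      CM.IotaFull K c ℓ × CM.IotaEssSurj K c ℓ × CM.RRightAdjoint K c ℓ
mainTheorem1 K _ _ c ℓ = ι-full , ι-essSurj , R-rightAdjoint
  where open Adjunction K c ℓ
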